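{- Let $\mathcal{D}_h$ be a complete abstraction of $\mathcal{D}_l$ relative to a refinement mapping $m$. Then for any sequence of ground high-level actions $\vec\alpha$ and any high-level situation-suppressed formula $\phi$: if $\mathcal{D}_h\cup\{Executable(do(\vec\alpha,S_0))\land\phi[do(\vec\alpha,S_0)]\}$ is satisfiable, then $\mathcal{D}_l\cup\mathcal{C}\cup\{\exists s.\,Do(m(\vec\alpha),S_0,s)\land m(\phi)[s]\}$ is satisfiable. In particular, if $\mathcal{D}_h\cup\{Executable(do(\vec\alpha,S_0))\}$ is satisfiable, then $\mathcal{D}_l\cup\mathcal{C}\cup\{\exists s.\,Do(m(\vec\alpha),S_0,s)\}$ is satisfiable.
   Context: Situation calculus setting. Objects are a countably infinite set $\mathcal{N}$ of standard names (unique names and domain closure); no function symbols other than constants; no non-fluent predicates. Situations: $S_0$ and $do(a,s)$; $do([a_1,\dots,a_n],s)$ abbreviates $do(a_n,\dots,do(a_1,s)\dots)$, also written $do(\vec a,s)$. $Poss(a,s)$ means $a$ is executable in $s$; $Executable(s)$ means every action along the history from $S_0$ to $s$ was possible where performed. A basic action theory (BAT) over finitely many action types $\mathcal{A}$ and fluents $\mathcal{F}$ consists of initial-state axioms $\mathcal{D}_{S_0}$, precondition axioms $Poss(A(\vec x),s)\equiv\phi^{Poss}_A(\vec x,s)$, successor state axioms $F(\vec x,do(a,s))\equiv\phi^{ssa}_F(\vec x,a,s)$ (right-hand sides uniform in $s$), unique names/domain closure axioms for actions $\mathcal{D}_{ca}$ and for objects $\mathcal{D}_{coa}$, and foundational axioms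 $\Sigma$. A situation-suppressed formula omits situation arguments of fluents; $\phi[s]$ restores $s$. ConGolog programs $\delta::=\alpha\mid\varphi?\mid\delta_1;\delta_2\mid\delta_1|\delta_2\mid\pi x.\delta\mid\delta^*\mid\delta_1\|\delta_2$, $nil=True?$; $\mathcal{C}$ are the axioms: $Trans(\alpha,s,\delta',s')\equiv s'=do(\alpha,s)\land Poss(\alpha,s)\land\delta'=True?$; $Trans(\varphi?,s,\delta',s')\equiv False$; $Trans(\delta_1;\delta_2,s,\delta',s')\equiv\exists\delta_1'(Trans(\delta_1,s,\delta_1',s')\land\delta'=\delta_1';\delta_2)\lor(Final(\delta_1,s)\land Trans(\delta_2,s,\delta',s'))$; $Trans(\delta_1|\delta_2,\cdot)\equiv Trans(\delta_1,\cdot)\lor Trans(\delta_2,\cdot)$; $Trans(\pi x.\delta,s,\delta',s')\equiv\exists x.Trans(\delta,s,\delta',s')$; $Trans(\delta^*,s,\delta',s')\equiv\exists\delta''(Trans(\delta,s,\delta'',s')\land\delta'=\delta'';\delta^*)$; $Trans(\delta_1\|\delta_2,s,\delta',s')\equiv\exists\delta_1'(Trans(\delta_1,s,\delta_1',s')\land\delta'=\delta_1'\|\delta_2)\lor\exists\delta_2'(Trans(\delta_2,s,\delta_2',s')\land\delta'=\delta_1\|\delta_2')$; $Final(\alpha,s)\equiv False$; $Final(\varphi?,s)\equiv\varphi[s]$; $Final(\delta_1;\delta_2,s)\equiv Final(\delta_1,s)\land Final(\delta_2,s)$; $Final(\delta_1|\delta_2,s)\equiv Final(\delta_1,s)\lor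 Final(\delta_2,s)$; $Final(\pi x.\delta,s)\equiv\exists x.Final(\delta,s)$; $Final(\delta^*,s)\equiv True$; $Final(\delta_1\|\delta_2,s)\equiv Final(\delta_1,s)\land Final(\delta_2,s)$. $Do(\delta,s,s')\doteq\exists\delta'.Trans^*(\delta,s,\delta',s')\land Final(\delta',s')$, $Trans^*$ the reflexive transitive closure. $\mathcal{D}_h$ (high-level) and $\mathcal{D}_l$ (low-level) are BATs with action types $\mathcal{A}_h,\mathcal{A}_l$ and fluents $\mathcal{F}_h,\mathcal{F}_l$, sharing only $\mathcal{N}$. A refinement mapping $m$ maps each $A\in\mathcal{A}_h$ to a situation-determined ConGolog program $m(A(\vec x))$ over $\mathcal{D}_l$ with free variables $\vec x$, and each $F\in\mathcal{F}_h$ to a situation-suppressed low-level formula $m(F(\vec x))$; $m(\phi)$ substitutes $m(F(\vec x))$ for fluent atoms; $m(\alpha_1,\dots,\alpha_n)=m(\alpha_1);\dots;m(\alpha_n)$, $m(\epsilon)=nil$. For a model $M_h$ of $\mathcal{D}_h$ and a model $M_l$ of $\mathcal{D}_l\cup\mathcal{C}$: $s_h\simeq_m^{M_h,M_l}s_l$ iff for all $F\in\mathcal{F}_h$ and assignments $v$, $M_h,v[s/s_h]\models F(\vec x,s)$ iff $M_l,v[s/s_l]\models m(F(\vec x))[s]$. A relation $B$ between situation domains is an $m$-bisimulation if each $\langle s_h,s_l\rangle\in B$ satisfies: (1) $s_h\simeq_m^{M_h,M_l}s_l$; (2) for each $A\in\mathcal{A}_h$ and $v$, if some $s_h'$ has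 $M_h,v[s/s_h,s'/s_h']\models Poss(A(\vec x),s)\land s'=do(A(\vec x),s)$ then some $s_l'$ has $M_l,v[s/s_l,s'/s_l']\models Do(m(A(\vec x)),s,s')$ and $\langle s_h',s_l'\rangle\in B$; (3) conversely, if some $s_l'$ has $M_l,v[s/s_l,s'/s_l']\models Do(m(A(\vec x)),s,s')$ then some $s_h'$ has $M_h,v[s/s_h,s'/s_h']\models Poss(A(\vec x),s)\land s'=do(A(\vec x),s)$ and $\langle s_h',s_l'\rangle\in B$. $M_h\sim_m M_l$ iff some $m$-bisimulation contains $\langle S_0^{M_h},S_0^{M_l}\rangle$. $\mathcal{D}_h$ is a complete abstraction of $\mathcal{D}_l$ relative to $m$ iff for every model $M_h$ of $\mathcal{D}_h$ there is a model $M_l$ of $\mathcal{D}_l\cup\mathcal{C}$ with $M_h\sim_m M_l$. -}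

module Defs where

open import Data.Nat using (ℕ; zero; suc)
open import Data.Fin using (Fin; zero; suc)
open import Data.Bool using (Bool; true; false)
open import Data.Vec using (Vec; []; _∷_; map; lookup)
open import Data.List using (List; []; _∷_)
open import Data.Product using (Σ; _×_; _,_)
open import Data.Empty using (⊥)
open import Data.Unit using (⊤)
open import Data.Sum using (_⊎_)
open import Relation.Nullary using (¬_)
open import Relation.Binary.PropositionalEquality using (_≡_)
open import Relation.Binary.Construct.Closure.ReflexiveTransitive using (Star)
open import Function.Bundles using (_⇔_)

-- Signatures: finitely many action types and fluents, with arities.
-- Objects are the standard names ℕ (unique names + domain closure).

record Sig : Set where
  field
    nA  : ℕ
    aAr : Fin nA → ℕ
    nF  : ℕ
    fAr : Fin nF → ℕ
open Sig public

-- Ground actions (unique names + domain closure for actions).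
data Action (L : Sig) : Set where
  mkAct : (A : Fin (nA L)) → Vec ℕ (aAr L A) → Action L

-- Situations (foundational axioms): the tree generated by S0 and do.
data Sit (L : Sig) : Set where
  S0  : Sit L
  doA : Action L → Sit L → Sit L

doSeq : {L : Sig} → List (Action L) → Sit L → Sit L
doSeq []       s = s
doSeq (a ∷ as) s = doSeq as (doA a s)

-- Situation-suppressed formulas.
-- Fm L b k n : k action variables, n object variables in scope;
-- b = true allows action terms (equality of actions, action quantifiers).

data OTerm (n : ℕ) : Set where
  var : Fin n → OTerm n
  nm  : ℕ → OTerm n

data ATerm (L : Sig) (k n : ℕ) : Set where
  avar : Fin k → ATerm L k n
  act  : (A : Fin (nA L)) → Vec (OTerm n) (aAr L A) → ATerm L k n

data Fm (L : Sig) : Bool → ℕ → ℕ → Set where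
  Tru Fls : ∀ {b k n} → Fm L b k n
  Fl   : ∀ {b k n} (F : Fin (nF L)) → Vec (OTerm n) (fAr L F) → Fm L b k n
  EqO  : ∀ {b k n} → OTerm n → OTerm n → Fm L b k n
  EqA  : ∀ {k n} → ATerm L k n → ATerm L k n → Fm L true k n
  Not  : ∀ {b k n} → Fm L b k n → Fm L b k n
  And Or Imp : ∀ {b k n} → Fm L b k n → Fm L b k n → Fm L b k n
  ExO AllO : ∀ {b k n} → Fm L b k (suc n) → Fm L b k n
  ExA AllA : ∀ {k n} → Fm L true (suc k) n → Fm L true k n

-- Models: object domain ℕ, action domain Action L, situation domain Sit L;
-- interpretations of the fluents and of Poss.
record Model (L : Sig) : Set₁ where
  field
    Flu  : (F : Fin (nF L)) → Vec ℕ (fAr L F) → Sit L → Set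
    Poss : Action L → Sit L → Set
open Model public

evO : ∀ {n} → Vec ℕ n → OTerm n → ℕ
evO ρ (var i) = lookup ρ i
evO ρ (nm c)  = c

evA : ∀ {L k n} → Vec (Action L) k → Vec ℕ n → ATerm L k n → Action L
evA α ρ (avar i)  = lookup α i
evA α ρ (act A ts) = mkAct A (map (evO ρ) ts)

⟦_⟧ : ∀ {L b k n} → Fm L b k n → Model L → Vec (Action L) k → Vec ℕ n → Sit L → Set
⟦ Tru ⟧      M α ρ s = ⊤
⟦ Fls ⟧      M α ρ s = ⊥
⟦ Fl F ts ⟧  M α ρ s = Flu M F (map (evO ρ) ts) s
⟦ EqO t u ⟧  M α ρ s = evO ρ t ≡ evO ρ u
⟦ EqA t u ⟧  M α ρ s = evA α ρ t ≡ evA α ρ u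
⟦ Not φ ⟧    M α ρ s = ¬ ⟦ φ ⟧ M α ρ s
⟦ And φ ψ ⟧  M α ρ s = ⟦ φ ⟧ M α ρ s × ⟦ ψ ⟧ M α ρ s
⟦ Or φ ψ ⟧   M α ρ s = ⟦ φ ⟧ M α ρ s ⊎ ⟦ ψ ⟧ M α ρ s
⟦ Imp φ ψ ⟧  M α ρ s = ⟦ φ ⟧ M α ρ s → ⟦ ψ ⟧ M α ρ s
⟦ ExO φ ⟧    M α ρ s = Σ ℕ (λ c → ⟦ φ ⟧ M α (c ∷ ρ) s)
⟦ AllO φ ⟧   M α ρ s = (c : ℕ) → ⟦ φ ⟧ M α (c ∷ ρ) s
⟦ ExA φ ⟧    M α ρ s = Σ (Action _) (λ a → ⟦ φ ⟧ M (a ∷ α) ρ s)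
⟦ AllA φ ⟧   M α ρ s = (a : Action _) → ⟦ φ ⟧ M (a ∷ α) ρ s

record BAT (L : Sig) : Set₁ where
  field
    Init   : Fm L true 0 0 → Set
    PossAx : (A : Fin (nA L)) → Fm L true 0 (aAr L A)
    SSA    : (F : Fin (nF L)) → Fm L true 1 (fAr L F)
open BAT public

ModelOf : ∀ {L} → BAT L → Model L → Set
ModelOf {L} D M =
  ((ψ : Fm L true 0 0) → Init D ψ → ⟦ ψ ⟧ M [] [] S0)
  × ((A : Fin (nA L)) (xs : Vec ℕ (aAr L A)) (s : Sit L) →
       Poss M (mkAct A xs) s ⇔ ⟦ PossAx D A ⟧ M [] xs s)
  × ((F : Fin (nF L)) (xs : Vec ℕ (fAr L F)) (a : Action L) (s : Sit L) →
       Flu M F xs (doA a s) ⇔ ⟦ SSA D F ⟧ M (a ∷ []) xs s)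

Executable : ∀ {L} → Model L → Sit L → Set
Executable M S0        = ⊤
Executable M (doA a s) = Poss M a s × Executable M s

wkO : ∀ {n} → OTerm n → OTerm (suc n)
wkO (var i) = var (suc i)
wkO (nm c)  = nm c

liftS : ∀ {n m} → (Fin n → OTerm m) → Fin (suc n) → OTerm (suc m)
liftS σ zero    = var zero
liftS σ (suc i) = wkO (σ i)

subO : ∀ {n m} → (Fin n → OTerm m) → OTerm n → OTerm m
subO σ (var i) = σ i
subO σ (nm c)  = nm c

subA : ∀ {L k n m} → (Fin n → OTerm m) → ATerm L k n → ATerm L k m
subA σ (avar i)   = avar i
subA σ (act A ts) = act A (map (subO σ) ts)

subF : ∀ {L b k n m} → (Fin n → OTerm m) → Fm L b k n → Fm L b k m
subF σ Tru        = Tru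
subF σ Fls        = Fls
subF σ (Fl F ts)  = Fl F (map (subO σ) ts)
subF σ (EqO t u)  = EqO (subO σ t) (subO σ u)
subF σ (EqA t u)  = EqA (subA σ t) (subA σ u)
subF σ (Not φ)    = Not (subF σ φ)
subF σ (And φ ψ)  = And (subF σ φ) (subF σ ψ)
subF σ (Or φ ψ)   = Or (subF σ φ) (subF σ ψ)
subF σ (Imp φ ψ)  = Imp (subF σ φ) (subF σ ψ)
subF σ (ExO φ)    = ExO (subF (liftS σ) φ)
subF σ (AllO φ)   = AllO (subF (liftS σ) φ)
subF σ (ExA φ)    = ExA (subF σ φ)
subF σ (AllA φ)   = AllA (subF σ φ)

data Prog (L : Sig) (n : ℕ) : Set where
  Act    : (A : Fin (nA L)) → Vec (OTerm n) (aAr L A) → Prog L n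
  Test   : Fm L true 0 n → Prog L n
  Seq    : Prog L n → Prog L n → Prog L n
  Choice : Prog L n → Prog L n → Prog L n
  Pick   : Prog L (suc n) → Prog L n
  Star*  : Prog L n → Prog L n
  Conc   : Prog L n → Prog L n → Prog L n

nil : ∀ {L n} → Prog L n
nil = Test Tru

subP : ∀ {L n m} → (Fin n → OTerm m) → Prog L n → Prog L m
subP σ (Act A ts)     = Act A (map (subO σ) ts)
subP σ (Test φ)       = Test (subF σ φ)
subP σ (Seq d e)      = Seq (subP σ d) (subP σ e)
subP σ (Choice d e)   = Choice (subP σ d) (subP σ e)
subP σ (Pick d)       = Pick (subP (liftS σ) d)
subP σ (Star* d)      = Star* (subP σ d)
subP σ (Conc d e)     = Conc (subP σ d) (subP σ e)

inst : ∀ {L n} → Prog L n → Vec ℕ n → Prog L 0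
inst d xs = subP (λ i → nm (lookup xs i)) d

-- The axioms C (Final and Trans), read in a model M.
data Final {L : Sig} (M : Model L) : Prog L 0 → Sit L → Set where
  f-test  : ∀ {φ s} → ⟦ φ ⟧ M [] [] s → Final M (Test φ) s
  f-seq   : ∀ {d e s} → Final M d s → Final M e s → Final M (Seq d e) s
  f-ch₁   : ∀ {d e s} → Final M d s → Final M (Choice d e) s
  f-ch₂   : ∀ {d e s} → Final M e s → Final M (Choice d e) s
  f-pick  : ∀ {d s} (c : ℕ) → Final M (inst d (c ∷ [])) s → Final M (Pick d) s
  f-star  : ∀ {d s} → Final M (Star* d) s
  f-conc  : ∀ {d e s} → Final M d s → Final M e s → Final M (Conc d e) s

data Trans {L : Sig} (M : Model L) : Prog L 0 → Sit L → Prog L 0 → Sit L → Set where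
  t-act   : ∀ {A ts s} → Poss M (mkAct A (map (evO []) ts)) s →
              Trans M (Act A ts) s (Test Tru) (doA (mkAct A (map (evO []) ts)) s)
  t-seq₁  : ∀ {d d' e s s'} → Trans M d s d' s' → Trans M (Seq d e) s (Seq d' e) s'
  t-seq₂  : ∀ {d e e' s s'} → Final M d s → Trans M e s e' s' → Trans M (Seq d e) s e' s'
  t-ch₁   : ∀ {d e d' s s'} → Trans M d s d' s' → Trans M (Choice d e) s d' s'
  t-ch₂   : ∀ {d e d' s s'} → Trans M e s d' s' → Trans M (Choice d e) s d' s'
  t-pick  : ∀ {d d' s s'} (c : ℕ) → Trans M (inst d (c ∷ [])) s d' s' → Trans M (Pick d) s d' s'
  t-star  : ∀ {d d'' s s'} → Trans M d s d'' s' → Trans M (Star* d) s (Seq d'' (Star* d)) s'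
  t-conc₁ : ∀ {d d' e s s'} → Trans M d s d' s' → Trans M (Conc d e) s (Conc d' e) s'
  t-conc₂ : ∀ {d e e' s s'} → Trans M e s e' s' → Trans M (Conc d e) s (Conc d e') s'

Config : Sig → Set
Config L = Prog L 0 × Sit L

Step : ∀ {L} → Model L → Config L → Config L → Set
Step M (d , s) (d' , s') = Trans M d s d' s'

TransStar : ∀ {L} → Model L → Prog L 0 → Sit L → Prog L 0 → Sit L → Set
TransStar M d s d' s' = Star (Step M) (d , s) (d' , s')

Do : ∀ {L} → Model L → Prog L 0 → Sit L → Sit L → Set
Do {L} M d s s' = Σ (Prog L 0) (λ d' → TransStar M d s d' s' × Final M d' s')

SitDetermined : ∀ {L} → Model L → Prog L 0 → Sit L → Set
SitDetermined {L} M d s =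
  (d₁ d₂ : Prog L 0) (s' : Sit L) → TransStar M d s d₁ s' → TransStar M d s d₂ s' → d₁ ≡ d₂

record Refinement (Lh Ll : Sig) (Dl : BAT Ll) : Set₁ where
  field
    mA : (A : Fin (nA Lh)) → Prog Ll (aAr Lh A)
    mF : (F : Fin (nF Lh)) → Fm Ll true 0 (fAr Lh F)
    mA-sd : (M : Model Ll) → ModelOf Dl M →
            (A : Fin (nA Lh)) (xs : Vec ℕ (aAr Lh A)) (s : Sit Ll) →
            SitDetermined M (inst (mA A) xs) s
open Refinement public

module _ {Lh Ll : Sig} {Dl : BAT Ll} (m : Refinement Lh Ll Dl) where

  mFm : ∀ {n} → Fm Lh false 0 n → Fm Ll true 0 n
  mFm Tru        = Tru
  mFm Fls        = Fls
  mFm (Fl F ts)  = subF (λ i → lookup ts i) (mF m F)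
  mFm (EqO t u)  = EqO t u
  mFm (Not φ)    = Not (mFm φ)
  mFm (And φ ψ)  = And (mFm φ) (mFm ψ)
  mFm (Or φ ψ)   = Or (mFm φ) (mFm ψ)
  mFm (Imp φ ψ)  = Imp (mFm φ) (mFm ψ)
  mFm (ExO φ)    = ExO (mFm φ)
  mFm (AllO φ)   = AllO (mFm φ)

  mAct : Action Lh → Prog Ll 0
  mAct (mkAct A xs) = inst (mA m A) xs

  mSeq : List (Action Lh) → Prog Ll 0
  mSeq []           = nil
  mSeq (a ∷ [])     = mAct a
  mSeq (a ∷ b ∷ as) = Seq (mAct a) (mSeq (b ∷ as))

  SimSit : Model Lh → Model Ll → Sit Lh → Sit Ll → Set
  SimSit Mh Ml sh sl = (F : Fin (nF Lh)) (xs : Vec ℕ (fAr Lh F)) →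
                       Flu Mh F xs sh ⇔ ⟦ mF m F ⟧ Ml [] xs sl

  IsBisim : Model Lh → Model Ll → (Sit Lh → Sit Ll → Set) → Set
  IsBisim Mh Ml B =
    (sh : Sit Lh) (sl : Sit Ll) → B sh sl →
      SimSit Mh Ml sh sl
      × ((A : Fin (nA Lh)) (xs : Vec ℕ (aAr Lh A)) →
           Poss Mh (mkAct A xs) sh →
           Σ (Sit Ll) (λ sl' → Do Ml (mAct (mkAct A xs)) sl sl' × B (doA (mkAct A xs) sh) sl'))
      × ((A : Fin (nA Lh)) (xs : Vec ℕ (aAr Lh A)) (sl' : Sit Ll) →
           Do Ml (mAct (mkAct A xs)) sl sl' →
           Poss Mh (mkAct A xs) sh × B (doA (mkAct A xs) sh) sl')

  Bisimilar : Model Lh → Model Ll → Set₁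
  Bisimilar Mh Ml = Σ (Sit Lh → Sit Ll → Set) (λ B → IsBisim Mh Ml B × B S0 S0)

  CompleteAbstraction : BAT Lh → Set₁
  CompleteAbstraction Dh =
    (Mh : Model Lh) → ModelOf Dh Mh →
    Σ (Model Ll) (λ Ml → ModelOf Dl Ml × Bisimilar Mh Ml)

module Submission where

-- An m-bisimulation matches every executable high-level action by a terminating
-- run of its refinement and relates the resulting situations again; iterating
-- this along α⃗ from the bisimilar initial situations yields a low-level run of
-- m(α⃗) ending in a situation that agrees with do(α⃗, S0) on every mapped fluent.
-- Since m commutes with the connectives, agreement on fluents lifts to every
-- fluent formula φ, so φ[do(α⃗, S0)] gives m(φ)[s] in the model that complete
-- abstraction provides.

open import Defs
open import Data.Nat using (ℕ)
open import Data.Fin using (Fin; zero; suc)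
open import Data.Bool using (false)
open import Data.List using (List; []; _∷_)
open import Data.Vec using (Vec; []; _∷_; map; lookup)
open import Data.Vec.Properties using (map-∘; map-cong; lookup-map)
open import Data.Product using (Σ; _×_; _,_; proj₁; proj₂; ∃-syntax)
open import Data.Product.Function.NonDependent.Propositional using (_×-⇔_)
open import Data.Product.Function.Dependent.Propositional using (Σ-⇔)
open import Data.Sum.Function.Propositional using (_⊎-⇔_)
open import Data.Unit using (tt)
open import Function.Bundles using (_⇔_; mk⇔; Equivalence)
open import Function.Construct.Identity using (⇔-id; ↠-id)
open import Function.Construct.Symmetry using (⇔-sym)
open import Function.Construct.Composition using (_⇔-∘_)
open import Function.Related.TypeIsomorphisms using (→-cong-⇔; ¬-cong-⇔)
open import Relation.Binary.PropositionalEquality using (_≡_; refl; sym; trans; cong)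
open import Relation.Binary.Construct.Closure.ReflexiveTransitive using (ε; _◅_; _◅◅_; gmap)

∀-cong-⇔ : {A : Set} {P Q : A → Set} → (∀ x → P x ⇔ Q x) → (∀ x → P x) ⇔ (∀ x → Q x)
∀-cong-⇔ P⇔Q = mk⇔ (λ f x → Equivalence.to (P⇔Q x) (f x)) (λ f x → Equivalence.from (P⇔Q x) (f x))

∃-cong-⇔ : {A : Set} {P Q : A → Set} → (∀ x → P x ⇔ Q x) → Σ A P ⇔ Σ A Q
∃-cong-⇔ P⇔Q = Σ-⇔ (↠-id _) (P⇔Q _)

evO-wkO : ∀ {n c} {ρ : Vec ℕ n} t → evO (c ∷ ρ) (wkO t) ≡ evO ρ t
evO-wkO (var _) = refl
evO-wkO (nm _)  = refl

record Evaluates {n k} (σ : Fin n → OTerm k) (ρ : Vec ℕ k) (ρ′ : Vec ℕ n) : Set where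
  constructor evaluates
  field evO-lookup : ∀ i → evO ρ (σ i) ≡ lookup ρ′ i

module _ {n k} {σ : Fin n → OTerm k} {ρ : Vec ℕ k} {ρ′ : Vec ℕ n} (σ↦ρ′ : Evaluates σ ρ ρ′) where

  evO-subO : ∀ t → evO ρ (subO σ t) ≡ evO ρ′ t
  evO-subO (var i) = Evaluates.evO-lookup σ↦ρ′ i
  evO-subO (nm c)  = refl

  map-evO-subO : ∀ {j} (ts : Vec (OTerm n) j) → map (evO ρ) (map (subO σ) ts) ≡ map (evO ρ′) ts
  map-evO-subO ts = trans (sym (map-∘ (evO ρ) (subO σ) ts)) (map-cong evO-subO ts)

  evA-subA : ∀ {L j} {α : Vec (Action L) j} t → evA α ρ (subA σ t) ≡ evA α ρ′ t
  evA-subA (avar i)   = refl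
  evA-subA (act A ts) = cong (mkAct A) (map-evO-subO ts)

  liftS-evaluates : ∀ c → Evaluates (liftS σ) (c ∷ ρ) (c ∷ ρ′)
  liftS-evaluates c = evaluates λ where
    zero    → refl
    (suc i) → trans (evO-wkO (σ i)) (Evaluates.evO-lookup σ↦ρ′ i)

subF-correct : ∀ {L b j n k} {M : Model L} {α : Vec (Action L) j} {s : Sit L}
  {σ : Fin n → OTerm k} {ρ : Vec ℕ k} {ρ′ : Vec ℕ n} →
  Evaluates σ ρ ρ′ → (φ : Fm L b j n) → ⟦ subF σ φ ⟧ M α ρ s ⇔ ⟦ φ ⟧ M α ρ′ s
subF-correct σ↦ρ′ Tru       = ⇔-id _
subF-correct σ↦ρ′ Fls       = ⇔-id _
subF-correct σ↦ρ′ (Fl F ts) rewrite map-evO-subO σ↦ρ′ ts = ⇔-id _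
subF-correct σ↦ρ′ (EqO t u) rewrite evO-subO σ↦ρ′ t | evO-subO σ↦ρ′ u = ⇔-id _
subF-correct {α = α} σ↦ρ′ (EqA t u)
  rewrite evA-subA σ↦ρ′ {α = α} t | evA-subA σ↦ρ′ {α = α} u = ⇔-id _
subF-correct σ↦ρ′ (Not φ)   = ¬-cong-⇔ (subF-correct σ↦ρ′ φ)
subF-correct σ↦ρ′ (And φ ψ) = subF-correct σ↦ρ′ φ ×-⇔ subF-correct σ↦ρ′ ψ
subF-correct σ↦ρ′ (Or φ ψ)  = subF-correct σ↦ρ′ φ ⊎-⇔ subF-correct σ↦ρ′ ψ
subF-correct σ↦ρ′ (Imp φ ψ) = →-cong-⇔ (subF-correct σ↦ρ′ φ) (subF-correct σ↦ρ′ ψ)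
subF-correct σ↦ρ′ (ExO φ)   = ∃-cong-⇔ λ c → subF-correct (liftS-evaluates σ↦ρ′ c) φ
subF-correct σ↦ρ′ (AllO φ)  = ∀-cong-⇔ λ c → subF-correct (liftS-evaluates σ↦ρ′ c) φ
subF-correct σ↦ρ′ (ExA φ)   = ∃-cong-⇔ λ a → subF-correct σ↦ρ′ φ
subF-correct σ↦ρ′ (AllA φ)  = ∀-cong-⇔ λ a → subF-correct σ↦ρ′ φ

module _ {Lh Ll : Sig} {Dl : BAT Ll} (m : Refinement Lh Ll Dl) {Mh : Model Lh} {Ml : Model Ll}
         {sh : Sit Lh} {sl : Sit Ll} (sh≃sl : SimSit m Mh Ml sh sl) where

  mFm-correct : ∀ {n} {ρ : Vec ℕ n} (φ : Fm Lh false 0 n) → ⟦ φ ⟧ Mh [] ρ sh ⇔ ⟦ mFm m φ ⟧ Ml [] ρ sl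
  mFm-correct Tru            = ⇔-id _
  mFm-correct Fls            = ⇔-id _
  mFm-correct {ρ = ρ} (Fl F ts) =
    ⇔-sym (subF-correct (evaluates λ i → sym (lookup-map i (evO ρ) ts)) (mF m F)) ⇔-∘ sh≃sl F (map (evO ρ) ts)
  mFm-correct (EqO t u)      = ⇔-id _
  mFm-correct (Not φ)        = ¬-cong-⇔ (mFm-correct φ)
  mFm-correct (And φ ψ)      = mFm-correct φ ×-⇔ mFm-correct ψ
  mFm-correct (Or φ ψ)       = mFm-correct φ ⊎-⇔ mFm-correct ψ
  mFm-correct (Imp φ ψ)      = →-cong-⇔ (mFm-correct φ) (mFm-correct ψ)
  mFm-correct (ExO φ)        = ∃-cong-⇔ λ c → mFm-correct φ
  mFm-correct (AllO φ)       = ∀-cong-⇔ λ c → mFm-correct φ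

module _ {L : Sig} {M : Model L} where

  TransStar-seq : ∀ {d d′ e s s′} → TransStar M d s d′ s′ → TransStar M (Seq d e) s (Seq d′ e) s′
  TransStar-seq {e = e} = gmap (λ { (d , s) → Seq d e , s }) t-seq₁

  Do-seq : ∀ {d e s s₁ s₂} → Do M d s s₁ → Do M e s₁ s₂ → Do M (Seq d e) s s₂
  Do-seq {e = e} (d′ , d↠ , d′-final) (e′ , ε , e′-final) =
    Seq d′ e , TransStar-seq d↠ , f-seq d′-final e′-final
  Do-seq (d′ , d↠ , d′-final) (e′ , t ◅ e↠ , e′-final) =
    e′ , TransStar-seq d↠ ◅◅ t-seq₂ d′-final t ◅ e↠ , e′-final

  Do-nil : ∀ {s s′} → Do M nil s s′ → s′ ≡ s
  Do-nil (_ , ε , _) = refl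

  executable-prefix : ∀ as {s} → Executable M (doSeq as s) → Executable M s
  executable-prefix []       ex = ex
  executable-prefix (a ∷ as) ex = proj₂ (executable-prefix as ex)

module _ {Lh Ll : Sig} {Dl : BAT Ll} (m : Refinement Lh Ll Dl) {Mh : Model Lh} {Ml : Model Ll} where

  Do-mSeq-∷ : ∀ a as {s s₁ s₂} → Do Ml (mAct m a) s s₁ → Do Ml (mSeq m as) s₁ s₂ → Do Ml (mSeq m (a ∷ as)) s s₂
  Do-mSeq-∷ a []      run rest with Do-nil rest
  ... | refl = run
  Do-mSeq-∷ a (_ ∷ _) run rest = Do-seq run rest

  bisim-refines-run : ∀ {B} → IsBisim m Mh Ml B → ∀ as {sh sl} → B sh sl → Executable Mh (doSeq as sh) →
    ∃[ sl′ ] Do Ml (mSeq m as) sl sl′ × B (doSeq as sh) sl′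
  bisim-refines-run isB []                 {sl = sl} related ex = sl , (nil , ε , f-test tt) , related
  bisim-refines-run isB (mkAct A xs ∷ as) {sh} {sl} related ex
    with proj₁ (proj₂ (isB sh sl related)) A xs (proj₁ (executable-prefix as ex))
  ... | sl₁ , run , related₁ with bisim-refines-run isB as related₁ ex
  ...   | sl′ , rest , related′ = sl′ , Do-mSeq-∷ (mkAct A xs) as run rest , related′

  bisimilar-refines-run : Bisimilar m Mh Ml → ∀ as → Executable Mh (doSeq as S0) →
    ∃[ sl ] Do Ml (mSeq m as) S0 sl × SimSit m Mh Ml (doSeq as S0) sl
  bisimilar-refines-run (B , isB , related₀) as ex with bisim-refines-run isB as related₀ ex
  ... | sl , run , related = sl , run , proj₁ (isB _ _ related)

corollary5 : {Lh Ll : Sig} (Dh : BAT Lh) (Dl : BAT Ll) (m : Refinement Lh Ll Dl) →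
    CompleteAbstraction m Dh →
    (αs : List (Action Lh)) →
    ((φ : Fm Lh false 0 0) →
      Σ (Model Lh) (λ Mh → ModelOf Dh Mh × Executable Mh (doSeq αs S0) × ⟦ φ ⟧ Mh [] [] (doSeq αs S0)) →
      Σ (Model Ll) (λ Ml → ModelOf Dl Ml ×
        Σ (Sit Ll) (λ s → Do Ml (mSeq m αs) S0 s × ⟦ mFm m φ ⟧ Ml [] [] s)))
    × (Σ (Model Lh) (λ Mh → ModelOf Dh Mh × Executable Mh (doSeq αs S0)) →
       Σ (Model Ll) (λ Ml → ModelOf Dl Ml × Σ (Sit Ll) (λ s → Do Ml (mSeq m αs) S0 s)))
corollary5 {Lh} Dh Dl m abstraction αs = preserves-φ , preserves-executability
  where
  refine : ∀ {Mh} → ModelOf Dh Mh → Executable Mh (doSeq αs S0) →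
    ∃[ Ml ] ModelOf Dl Ml × ∃[ sl ] Do Ml (mSeq m αs) S0 sl × SimSit m Mh Ml (doSeq αs S0) sl
  refine Mh⊨Dh ex with abstraction _ Mh⊨Dh
  ... | Ml , Ml⊨Dl , Mh∼Ml = Ml , Ml⊨Dl , bisimilar-refines-run m Mh∼Ml αs ex

  preserves-φ : (φ : Fm Lh false 0 0) →
    Σ (Model Lh) (λ Mh → ModelOf Dh Mh × Executable Mh (doSeq αs S0) × ⟦ φ ⟧ Mh [] [] (doSeq αs S0)) →
    ∃[ Ml ] ModelOf Dl Ml × ∃[ s ] Do Ml (mSeq m αs) S0 s × ⟦ mFm m φ ⟧ Ml [] [] s
  preserves-φ φ (Mh , Mh⊨Dh , ex , φ-holds) with refine Mh⊨Dh ex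
  ... | Ml , Ml⊨Dl , sl , run , sh≃sl = Ml , Ml⊨Dl , sl , run , Equivalence.to (mFm-correct m sh≃sl φ) φ-holds

  preserves-executability : Σ (Model Lh) (λ Mh → ModelOf Dh Mh × Executable Mh (doSeq αs S0)) →
    ∃[ Ml ] ModelOf Dl Ml × ∃[ s ] Do Ml (mSeq m αs) S0 s
  preserves-executability (Mh , Mh⊨Dh , ex) with refine Mh⊨Dh ex
  ... | Ml , Ml⊨Dl , sl , run , _ = Ml , Ml⊨Dl , sl , run
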